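{- Let $n\ge 7$ and let $\mathcal{K}=\{K\in\binom{[n]}{3}:|K\cap[3]|\ge 2\}$. Let $\mathcal{G}\subseteq\binom{[n]}{3}$ with $\mathcal{G}\cong\mathcal{K}$, let $i,j\in[n]$, and let $\mathcal{G}'\subseteq\binom{[n]}{3}$ be an intersecting family with $\sigma_{i,j}(\mathcal{G}')=\mathcal{G}$. Then $\mathcal{G}'\cong\mathcal{K}$.
   Context: $[m]=\{1,\dots,m\}$ and $\binom{X}{r}$ is the family of $r$-element subsets of $X$. Two families $\mathcal{A},\mathcal{B}$ of subsets of $[n]$ are isomorphic ($\mathcal{A}\cong\mathcal{B}$) if there is a permutation $\pi$ of $[n]$ with $\{\pi(A):A\in\mathcal{A}\}=\mathcal{B}$. A family is intersecting if any two of its members intersect. For $i,j\in[n]$ and $A\subseteq[n]$, $\sigma_{i,j}(A)=(A\setminus\{i\})\cup\{j\}$ if $i\in A$, $j\notin A$, and $\sigma_{i,j}(A)=A$ otherwise; for a family $\mathcal{F}$, $\sigma_{i,j}(\mathcal{F})=\{\sigma'_{i,j}(A):A\in\mathcal{F}\}$ where $\sigma'_{i,j}(A)=\sigma_{i,j}(A)$ if $\sigma_{i,j}(A)\notin\mathcal{F}$ and $\sigma'_{i,j}(A)=A$ otherwise. -}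

module Defs where

open import Data.Bool using (Bool; true; false; if_then_else_; _∧_; not)
open import Data.Nat using (ℕ; _<ᵇ_; _≡ᵇ_; _≤ᵇ_)
open import Data.Fin using (Fin; toℕ)
open import Data.Fin.Subset using (Subset; ∣_∣; _∩_; _∈_; Nonempty)
open import Data.Fin.Permutation using (Permutation; _⟨$⟩ʳ_; _⟨$⟩ˡ_)
open import Data.Vec using (lookup; tabulate; _[_]≔_)
open import Data.Product using (Σ; _×_; ∃)
open import Relation.Binary.PropositionalEquality using (_≡_)

Family : ℕ → Set
Family n = Subset n → Bool

⊆Triples : ∀ {n} → Family n → Set
⊆Triples {n} F = ∀ (A : Subset n) → F A ≡ true → ∣ A ∣ ≡ 3

first3 : ∀ {n} → Subset n
first3 = tabulate (λ x → toℕ x <ᵇ 3)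

𝒦 : ∀ {n} → Family n
𝒦 K = (∣ K ∣ ≡ᵇ 3) ∧ (2 ≤ᵇ ∣ K ∩ first3 ∣)

permImage : ∀ {n} → Permutation n n → Subset n → Subset n
permImage π A = tabulate (λ y → lookup A (π ⟨$⟩ˡ y))

-- 𝒜 ≅ ℬ : some permutation π of [n] has { π(A) : A ∈ 𝒜 } = ℬ
-- (stated as: A ∈ 𝒜 ⇔ π(A) ∈ ℬ for every A, π acting bijectively on subsets)
_≅_ : ∀ {n} → Family n → Family n → Set
_≅_ {n} 𝒜 ℬ = Σ (Permutation n n) λ π → ∀ (A : Subset n) → 𝒜 A ≡ ℬ (permImage π A)

Intersecting : ∀ {n} → Family n → Set
Intersecting {n} F =
  ∀ (A B : Subset n) → F A ≡ true → F B ≡ true → Nonempty (A ∩ B)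

σ : ∀ {n} → Fin n → Fin n → Subset n → Subset n
σ i j A = if lookup A i ∧ not (lookup A j) then (A [ i ]≔ false) [ j ]≔ true else A

σ' : ∀ {n} → Fin n → Fin n → Family n → Subset n → Subset n
σ' i j F A = if F (σ i j A) then A else σ i j A

-- the shifted family σ_{i,j}(F) = { σ'_{i,j}(A) : A ∈ F }, i.e.
-- B ∈ σ_{i,j}(F)  ⇔  ∃ A ∈ F with σ'_{i,j}(A) = B
IsShift : ∀ {n} → Fin n → Fin n → Family n → Family n → Set
IsShift {n} i j F G =
  ∀ (B : Subset n) →
    (G B ≡ true → ∃ λ A → F A ≡ true × σ' i j F A ≡ B) ×
    ((∃ λ A → F A ≡ true × σ' i j F A ≡ B) → G B ≡ true)

module Submission where

-- Write G = 𝒦⟨T⟩ = {A : |A| = 3, |A ∩ T| ≥ 2} with the 3-set T = π⁻¹([3]).  General facts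
-- about shifts (module Shifting) say that every set of G′ ∖ G (an "escapee") contains i but
-- not j and moves into G, and that G′ ⊆ G already forces G′ = G.  The move i → j can only
-- raise |A ∩ T| when j ∈ T and i ∉ T, so otherwise nothing escapes and G′ = G.
-- If j ∈ T = {j, u, b} and i ∉ T, call {i, w, y} lifted (w ∈ {u, b}, y ∉ T ∪ {i}) when it
-- lies in G′.  A set of G′ ∖ G misses j, hence is disjoint from {w, j, y} ∈ G, which therefore
-- was shifted from {i, w, y} (lemma `lift`).  Since lifted triples are themselves escapees,
-- this propagates (`spread`, using n ≥ 7 to find fresh points): either no triple is lifted,
-- so nothing escapes and G′ = G, or all are, and then sorting 3-sets by their trace on
-- {i, j} gives G′ = 𝒦⟨(T ∖ {j}) ∪ {i}⟩.  In both cases G′ is the image of 𝒦 under π or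
-- under π followed by the transposition (i j).

open import Defs
open import Data.Bool using (Bool; true; false; _∧_; _∨_; if_then_else_) renaming (T to IsTrue)
open import Data.Bool.Properties using (¬-not; ∧-zeroʳ; ⇔→≡)
open import Data.Nat using (ℕ; zero; suc; _+_; _≤_; _<_; z≤n; s≤s; _≤ᵇ_; _≡ᵇ_)
import Data.Nat.Properties as ℕ
open import Data.Fin using (Fin; zero; suc)
open import Data.Fin.Properties using (_≟_)
open import Data.Fin.Subset using (Subset; ∣_∣; _∩_; _∪_; Nonempty; ⊥; ⊤; ⁅_⁆)
open import Data.Fin.Permutation using (Permutation; _⟨$⟩ʳ_; _⟨$⟩ˡ_; inverseˡ; inverseʳ; flip; transpose; _∘ₚ_)
import Data.Fin.Permutation.Components as Components
open import Data.Fin.Subset.Properties using (∩-comm; ∩-identityʳ; ∩-zeroˡ; ∣⊥∣≡0; ∣⁅x⁆∣≡1; x∈⁅x⁆; x∈p∩q⁻)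
open import Data.Vec using ([]; _∷_; lookup; tabulate; _[_]≔_)
open import Data.Vec.Properties using (lookup∘tabulate; tabulate∘lookup; tabulate-cong; lookup∘update; lookup∘update′; lookup-replicate; lookup-zipWith; []≔-idempotent; []≔-lookup; []=⇒lookup)
open import Data.Product using (_×_; ∃; _,_; proj₁; proj₂)
open import Data.Sum using (_⊎_; inj₁; inj₂; [_,_]′)
open import Data.Empty using (⊥-elim)
open import Relation.Nullary using (¬_; yes; no)
open import Function.Bundles using (mk⇔)
open import Relation.Binary.PropositionalEquality

false≢true : {A : Set} → false ≡ true → A
false≢true ()

true≢false : {A : Set} → true ≡ false → A
true≢false ()

bool-ext : ∀ {x y : Bool} → (x ≡ true → y ≡ true) → (y ≡ true → x ≡ true) → x ≡ y
bool-ext x⇒y y⇒x = ⇔→≡ (mk⇔ x⇒y y⇒x)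

if-same : ∀ {A : Set} b (x : A) → (if b then x else x) ≡ x
if-same true x = refl
if-same false x = refl

⟦_⟧ : Bool → ℕ
⟦ true ⟧ = 1
⟦ false ⟧ = 0

subset-ext : ∀ {n} (u v : Subset n) → (∀ x → lookup u x ≡ lookup v x) → u ≡ v
subset-ext u v same = begin
  u                   ≡⟨ sym (tabulate∘lookup u) ⟩
  tabulate (lookup u) ≡⟨ tabulate-cong same ⟩
  tabulate (lookup v) ≡⟨ tabulate∘lookup v ⟩
  v                   ∎
  where open ≡-Reasoning

∩-lookup : ∀ {n} (p q : Subset n) x → lookup (p ∩ q) x ≡ lookup p x ∧ lookup q x
∩-lookup p q x = lookup-zipWith _∧_ x p q

∩-member : ∀ {n} (A S : Subset n) {x} → lookup A x ≡ true → lookup S x ≡ true → lookup (A ∩ S) x ≡ true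
∩-member A S {x} x∈A x∈S = trans (∩-lookup A S x) (cong₂ _∧_ x∈A x∈S)

∪-lookup : ∀ {n} (p q : Subset n) x → lookup (p ∪ q) x ≡ lookup p x ∨ lookup q x
∪-lookup p q x = lookup-zipWith _∨_ x p q

∪-outside : ∀ {n} (p q : Subset n) x → lookup (p ∪ q) x ≡ false →
  lookup p x ≡ false × lookup q x ≡ false
∪-outside p q x out with lookup p x | lookup q x | ∪-lookup p q x
... | false | false | _ = refl , refl
... | true  | _     | eq = true≢false (trans (sym eq) out)
... | false | true  | eq = true≢false (trans (sym eq) out)

outside-⁅⁆ : ∀ {n} {a y : Fin n} → lookup ⁅ a ⁆ y ≡ false → y ≢ a
outside-⁅⁆ {a = a} out refl = true≢false (trans (sym ([]=⇒lookup (x∈⁅x⁆ a))) out)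

∩-insert : ∀ {n} (v S : Subset n) x → lookup v x ≡ false →
  ∣ (v [ x ]≔ true) ∩ S ∣ ≡ ⟦ lookup S x ⟧ + ∣ v ∩ S ∣
∩-insert (false ∷ v) (true ∷ S) zero _ = refl
∩-insert (false ∷ v) (false ∷ S) zero _ = refl
∩-insert (c ∷ v) (s ∷ S) (suc x) x∉v with c ∧ s
... | true = trans (cong suc (∩-insert v S x x∉v)) (sym (ℕ.+-suc _ _))
... | false = ∩-insert v S x x∉v

reinsert : ∀ {n} (v : Subset n) x → lookup v x ≡ true → v ≡ (v [ x ]≔ false) [ x ]≔ true
reinsert v x x∈v = begin
  v                             ≡⟨ sym ([]≔-lookup v x) ⟩
  v [ x ]≔ lookup v x           ≡⟨ cong (v [ x ]≔_) x∈v ⟩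
  v [ x ]≔ true                 ≡⟨ sym ([]≔-idempotent v x) ⟩
  (v [ x ]≔ false) [ x ]≔ true  ∎
  where open ≡-Reasoning

∩-remove : ∀ {n} (v S : Subset n) x → lookup v x ≡ true →
  ∣ v ∩ S ∣ ≡ ⟦ lookup S x ⟧ + ∣ (v [ x ]≔ false) ∩ S ∣
∩-remove v S x x∈v = begin
  ∣ v ∩ S ∣                                ≡⟨ cong (λ w → ∣ w ∩ S ∣) (reinsert v x x∈v) ⟩
  ∣ ((v [ x ]≔ false) [ x ]≔ true) ∩ S ∣ ≡⟨ ∩-insert (v [ x ]≔ false) S x (lookup∘update x v false) ⟩
  ⟦ lookup S x ⟧ + ∣ (v [ x ]≔ false) ∩ S ∣ ∎
  where open ≡-Reasoning

-- Sizes are intersections with ⊤, so the plain versions follow.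
card-via-⊤ : ∀ {n} (v : Subset n) → ∣ v ∣ ≡ ∣ v ∩ ⊤ ∣
card-via-⊤ v = cong ∣_∣ (sym (∩-identityʳ v))

card-insert : ∀ {n} (v : Subset n) x → lookup v x ≡ false → ∣ v [ x ]≔ true ∣ ≡ suc ∣ v ∣
card-insert v x x∉v = begin
  ∣ v [ x ]≔ true ∣               ≡⟨ card-via-⊤ (v [ x ]≔ true) ⟩
  ∣ (v [ x ]≔ true) ∩ ⊤ ∣         ≡⟨ ∩-insert v ⊤ x x∉v ⟩
  ⟦ lookup ⊤ x ⟧ + ∣ v ∩ ⊤ ∣     ≡⟨ cong₂ (λ b m → ⟦ b ⟧ + m) (lookup-replicate x true) (sym (card-via-⊤ v)) ⟩
  suc ∣ v ∣                       ∎
  where open ≡-Reasoning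

card-remove : ∀ {n} (v : Subset n) x → lookup v x ≡ true → ∣ v ∣ ≡ suc ∣ v [ x ]≔ false ∣
card-remove v x x∈v = begin
  ∣ v ∣                                 ≡⟨ card-via-⊤ v ⟩
  ∣ v ∩ ⊤ ∣                             ≡⟨ ∩-remove v ⊤ x x∈v ⟩
  ⟦ lookup ⊤ x ⟧ + ∣ (v [ x ]≔ false) ∩ ⊤ ∣ ≡⟨ cong₂ (λ b m → ⟦ b ⟧ + m) (lookup-replicate x true) (sym (card-via-⊤ (v [ x ]≔ false))) ⟩
  suc ∣ v [ x ]≔ false ∣               ∎
  where open ≡-Reasoning

peel : ∀ {n k} (v : Subset n) x → lookup v x ≡ true → ∣ v ∣ ≡ suc k → ∣ v [ x ]≔ false ∣ ≡ k
peel v x x∈v size = ℕ.suc-injective (trans (sym (card-remove v x x∈v)) size)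

member-≤ : ∀ {n k} (v : Subset n) x → lookup v x ≡ true → k ≤ ∣ v [ x ]≔ false ∣ → suc k ≤ ∣ v ∣
member-≤ {k = k} v x x∈v k≤ = subst (suc k ≤_) (sym (card-remove v x x∈v)) (s≤s k≤)

still-member : ∀ {n} (v : Subset n) {x y} → y ≢ x → lookup v y ≡ true → lookup (v [ x ]≔ false) y ≡ true
still-member v y≢x y∈v = trans (lookup∘update′ y≢x v false) y∈v

removed-member : ∀ {n} (v : Subset n) {x y} → lookup (v [ x ]≔ false) y ≡ true → y ≢ x × lookup v y ≡ true
removed-member v {x} {y} y∈ = y≢x , trans (sym (lookup∘update′ y≢x v false)) y∈
  where
  y≢x : y ≢ x
  y≢x refl = false≢true (trans (sym (lookup∘update x v false)) y∈)

two-members : ∀ {n} (v : Subset n) p q → p ≢ q → lookup v p ≡ true → lookup v q ≡ true → 2 ≤ ∣ v ∣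
two-members v p q p≢q p∈ q∈ =
  member-≤ v p p∈ (member-≤ (v [ p ]≔ false) q (still-member v (λ e → p≢q (sym e)) q∈) z≤n)

three-members : ∀ {n} (v : Subset n) p q r → p ≢ q → p ≢ r → q ≢ r →
  lookup v p ≡ true → lookup v q ≡ true → lookup v r ≡ true → 3 ≤ ∣ v ∣
three-members v p q r p≢q p≢r q≢r p∈ q∈ r∈ =
  member-≤ v p p∈ (two-members (v [ p ]≔ false) q r q≢r (still-member v (λ e → p≢q (sym e)) q∈)
                                         (still-member v (λ e → p≢r (sym e)) r∈))

empty-lookup : ∀ {n} (v : Subset n) → ∣ v ∣ ≡ 0 → ∀ x → lookup v x ≡ false
empty-lookup (false ∷ v) empty zero = refl
empty-lookup (false ∷ v) empty (suc x) = empty-lookup v empty x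
empty-lookup (true ∷ v) () x

no-members : ∀ {n} (v : Subset n) → (∀ x → lookup v x ≡ false) → ∣ v ∣ ≡ 0
no-members [] _ = refl
no-members (false ∷ v) none = no-members v (λ x → none (suc x))
no-members (true ∷ v) none = true≢false (none zero)

some-member : ∀ {n k} (v : Subset n) → ∣ v ∣ ≡ suc k → ∃ λ x → lookup v x ≡ true
some-member (true ∷ v) _ = zero , refl
some-member (false ∷ v) size with some-member v size
... | x , x∈v = suc x , x∈v

some-outsider : ∀ {n} (v : Subset n) → ∣ v ∣ < n → ∃ λ x → lookup v x ≡ false
some-outsider (false ∷ v) _ = zero , refl
some-outsider (true ∷ v) (s≤s small) with some-outsider v small
... | x , x∉v = suc x , x∉v

card-∪ : ∀ {n} (p q : Subset n) → ∣ p ∪ q ∣ ≤ ∣ p ∣ + ∣ q ∣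
card-∪ [] [] = z≤n
card-∪ (true ∷ p) (true ∷ q) = s≤s (ℕ.≤-trans (card-∪ p q) (ℕ.+-monoʳ-≤ ∣ p ∣ (ℕ.n≤1+n _)))
card-∪ (true ∷ p) (false ∷ q) = s≤s (card-∪ p q)
card-∪ (false ∷ p) (true ∷ q) = subst (suc ∣ p ∪ q ∣ ≤_) (sym (ℕ.+-suc ∣ p ∣ ∣ q ∣)) (s≤s (card-∪ p q))
card-∪ (false ∷ p) (false ∷ q) = card-∪ p q

fresh : ∀ {n} → 7 ≤ n → (X : Subset n) → ∣ X ∣ ≤ 3 → (a c d : Fin n) →
  ∃ λ y → lookup X y ≡ false × y ≢ a × y ≢ c × y ≢ d
fresh {n} 7≤n X small a c d with some-outsider avoided (ℕ.≤-trans (s≤s bound) 7≤n)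
  where
  avoided = X ∪ (⁅ a ⁆ ∪ (⁅ c ⁆ ∪ ⁅ d ⁆))
  bound : ∣ avoided ∣ ≤ 6
  bound = begin
    ∣ avoided ∣                                          ≤⟨ card-∪ X _ ⟩
    ∣ X ∣ + ∣ ⁅ a ⁆ ∪ (⁅ c ⁆ ∪ ⁅ d ⁆) ∣                 ≤⟨ ℕ.+-monoʳ-≤ ∣ X ∣ (card-∪ ⁅ a ⁆ _) ⟩
    ∣ X ∣ + (∣ ⁅ a ⁆ ∣ + ∣ ⁅ c ⁆ ∪ ⁅ d ⁆ ∣)             ≤⟨ ℕ.+-monoʳ-≤ ∣ X ∣ (ℕ.+-monoʳ-≤ ∣ ⁅ a ⁆ ∣ (card-∪ ⁅ c ⁆ ⁅ d ⁆)) ⟩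
    ∣ X ∣ + (∣ ⁅ a ⁆ ∣ + (∣ ⁅ c ⁆ ∣ + ∣ ⁅ d ⁆ ∣))       ≡⟨ cong₂ (λ s t → ∣ X ∣ + (s + t)) (∣⁅x⁆∣≡1 a)
                                                             (cong₂ _+_ (∣⁅x⁆∣≡1 c) (∣⁅x⁆∣≡1 d)) ⟩
    ∣ X ∣ + 3                                            ≤⟨ ℕ.+-monoˡ-≤ 3 small ⟩
    6                                                    ∎
    where open ℕ.≤-Reasoning
... | y , y∉ with ∪-outside X _ y y∉
...   | y∉X , y∉acd with ∪-outside ⁅ a ⁆ _ y y∉acd
...     | y∉a , y∉cd with ∪-outside ⁅ c ⁆ ⁅ d ⁆ y y∉cd
...       | y∉c , y∉d = y , y∉X , outside-⁅⁆ y∉a , outside-⁅⁆ y∉c , outside-⁅⁆ y∉d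

pair : ∀ {n} → Fin n → Fin n → Subset n
pair p q = (⊥ [ p ]≔ true) [ q ]≔ true

triple : ∀ {n} → Fin n → Fin n → Fin n → Subset n
triple p q r = pair p q [ r ]≔ true

insert-keeps : ∀ {n} (v : Subset n) x {y} → lookup v y ≡ true → lookup (v [ x ]≔ true) y ≡ true
insert-keeps v x {y} y∈v with y ≟ x
... | yes refl = lookup∘update x v true
... | no y≢x = trans (lookup∘update′ y≢x v true) y∈v

triple-∋₁ : ∀ {n} (p q r : Fin n) → lookup (triple p q r) p ≡ true
triple-∋₁ p q r = insert-keeps (pair p q) r (insert-keeps (⊥ [ p ]≔ true) q (lookup∘update p ⊥ true))

triple-∋₂ : ∀ {n} (p q r : Fin n) → lookup (triple p q r) q ≡ true
triple-∋₂ p q r = insert-keeps (pair p q) r (lookup∘update q (⊥ [ p ]≔ true) true)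

triple-∋₃ : ∀ {n} (p q r : Fin n) → lookup (triple p q r) r ≡ true
triple-∋₃ p q r = lookup∘update r (pair p q) true

triple-∌ : ∀ {n} {p q r w : Fin n} → w ≢ p → w ≢ q → w ≢ r → lookup (triple p q r) w ≡ false
triple-∌ {p = p} {q} {r} {w} w≢p w≢q w≢r =
  trans (lookup∘update′ w≢r (pair p q) true) (trans (lookup∘update′ w≢q (⊥ [ p ]≔ true) true)
    (trans (lookup∘update′ w≢p ⊥ true) (lookup-replicate w false)))

triple-members : ∀ {n} {p q r w : Fin n} → lookup (triple p q r) w ≡ true → w ≡ p ⊎ w ≡ q ⊎ w ≡ r
triple-members {p = p} {q} {r} {w} w∈ with w ≟ p | w ≟ q | w ≟ r
... | yes w≡p | _ | _ = inj₁ w≡p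
... | no _ | yes w≡q | _ = inj₂ (inj₁ w≡q)
... | no _ | no _ | yes w≡r = inj₂ (inj₂ w≡r)
... | no w≢p | no w≢q | no w≢r = false≢true (trans (sym (triple-∌ w≢p w≢q w≢r)) w∈)

triple-∩ : ∀ {n} (p q r : Fin n) (S : Subset n) → p ≢ q → p ≢ r → q ≢ r →
  ∣ triple p q r ∩ S ∣ ≡ ⟦ lookup S r ⟧ + (⟦ lookup S q ⟧ + ⟦ lookup S p ⟧)
triple-∩ {n} p q r S p≢q p≢r q≢r = begin
  ∣ triple p q r ∩ S ∣
    ≡⟨ ∩-insert (pair p q) S r (trans (lookup∘update′ (≢-sym q≢r) (⊥ [ p ]≔ true) true) (trans (lookup∘update′ (≢-sym p≢r) ⊥ true)
                                                                     (lookup-replicate r false))) ⟩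
  ⟦ lookup S r ⟧ + ∣ pair p q ∩ S ∣
    ≡⟨ cong (⟦ lookup S r ⟧ +_) (∩-insert (⊥ [ p ]≔ true) S q (trans (lookup∘update′ (≢-sym p≢q) ⊥ true) (lookup-replicate q false))) ⟩
  ⟦ lookup S r ⟧ + (⟦ lookup S q ⟧ + ∣ (⊥ [ p ]≔ true) ∩ S ∣)
    ≡⟨ cong (λ m → ⟦ lookup S r ⟧ + (⟦ lookup S q ⟧ + m)) (∩-insert ⊥ S p (lookup-replicate p false)) ⟩
  ⟦ lookup S r ⟧ + (⟦ lookup S q ⟧ + (⟦ lookup S p ⟧ + ∣ ⊥ ∩ S ∣))
    ≡⟨ cong (λ m → ⟦ lookup S r ⟧ + (⟦ lookup S q ⟧ + (⟦ lookup S p ⟧ + m))) (trans (cong ∣_∣ (∩-zeroˡ S)) (∣⊥∣≡0 n)) ⟩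
  ⟦ lookup S r ⟧ + (⟦ lookup S q ⟧ + (⟦ lookup S p ⟧ + 0))
    ≡⟨ cong (λ m → ⟦ lookup S r ⟧ + (⟦ lookup S q ⟧ + m)) (ℕ.+-identityʳ _) ⟩
  ⟦ lookup S r ⟧ + (⟦ lookup S q ⟧ + ⟦ lookup S p ⟧) ∎
  where open ≡-Reasoning

triple-card : ∀ {n} (p q r : Fin n) → p ≢ q → p ≢ r → q ≢ r → ∣ triple p q r ∣ ≡ 3
triple-card p q r p≢q p≢r q≢r = begin
  ∣ triple p q r ∣      ≡⟨ card-via-⊤ (triple p q r) ⟩
  ∣ triple p q r ∩ ⊤ ∣  ≡⟨ triple-∩ p q r ⊤ p≢q p≢r q≢r ⟩
  ⟦ lookup ⊤ r ⟧ + (⟦ lookup ⊤ q ⟧ + ⟦ lookup ⊤ p ⟧)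
    ≡⟨ cong₂ (λ a b → ⟦ a ⟧ + b) (lookup-replicate r true)
         (cong₂ (λ a b → ⟦ a ⟧ + ⟦ b ⟧) (lookup-replicate q true) (lookup-replicate p true)) ⟩
  3                     ∎
  where open ≡-Reasoning

triple-disjoint : ∀ {n} {p q r : Fin n} (C : Subset n) →
  lookup C p ≡ false → lookup C q ≡ false → lookup C r ≡ false → ¬ Nonempty (triple p q r ∩ C)
triple-disjoint {p = p} {q} {r} C p∉C q∉C r∉C (x , x∈) with x∈p∩q⁻ (triple p q r) C x∈
... | x∈t , x∈C with triple-members {p = p} {q} {r} ([]=⇒lookup x∈t)
...   | inj₁ refl = true≢false (trans (sym ([]=⇒lookup x∈C)) p∉C)
...   | inj₂ (inj₁ refl) = true≢false (trans (sym ([]=⇒lookup x∈C)) q∉C)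
...   | inj₂ (inj₂ refl) = true≢false (trans (sym ([]=⇒lookup x∈C)) r∉C)

-- The families 𝒦⟨ S ⟩, of which 𝒦 and all its copies are instances.

𝒦⟨_⟩ : ∀ {n} → Subset n → Family n
𝒦⟨ S ⟩ A = (∣ A ∣ ≡ᵇ 3) ∧ (2 ≤ᵇ ∣ A ∩ S ∣)

≤ᵇ-true : ∀ {m k} → m ≤ k → (m ≤ᵇ k) ≡ true
≤ᵇ-true {m} {k} m≤k = ¬-not λ m≤ᵇk≡false → subst IsTrue m≤ᵇk≡false (ℕ.≤⇒≤ᵇ m≤k)

≤ᵇ-false : ∀ {m k} → k < m → (m ≤ᵇ k) ≡ false
≤ᵇ-false {m} {k} k<m = ¬-not λ m≤ᵇk≡true → ℕ.<⇒≱ k<m (ℕ.≤ᵇ⇒≤ m k (subst IsTrue (sym m≤ᵇk≡true) _))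

𝒦-on-triples : ∀ {n} (S A : Subset n) → ∣ A ∣ ≡ 3 → 𝒦⟨ S ⟩ A ≡ (2 ≤ᵇ ∣ A ∩ S ∣)
𝒦-on-triples S A size = cong (λ m → (m ≡ᵇ 3) ∧ (2 ≤ᵇ ∣ A ∩ S ∣)) size

𝒦-non-triple : ∀ {n} (S A : Subset n) → ∣ A ∣ ≢ 3 → 𝒦⟨ S ⟩ A ≡ false
𝒦-non-triple S A size≢3 with ∣ A ∣ ≡ᵇ 3 in size≡ᵇ3
... | true = ⊥-elim (size≢3 (ℕ.≡ᵇ⇒≡ ∣ A ∣ 3 (subst IsTrue (sym size≡ᵇ3) _)))
... | false = refl

𝒦-intro : ∀ {n} (S A : Subset n) → ∣ A ∣ ≡ 3 → 2 ≤ ∣ A ∩ S ∣ → 𝒦⟨ S ⟩ A ≡ true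
𝒦-intro S A size meets = trans (𝒦-on-triples S A size) (≤ᵇ-true meets)

𝒦-elim : ∀ {n} (S A : Subset n) → 𝒦⟨ S ⟩ A ≡ true → 2 ≤ ∣ A ∩ S ∣
𝒦-elim S A A∈ with ∣ A ∣ ≡ᵇ 3 | 2 ≤ᵇ ∣ A ∩ S ∣ in meets
... | true | true = ℕ.≤ᵇ⇒≤ 2 ∣ A ∩ S ∣ (subst IsTrue (sym meets) _)
... | true | false = false≢true A∈
... | false | _ = false≢true A∈

𝒦-reject : ∀ {n} (S A : Subset n) → ∣ A ∩ S ∣ < 2 → 𝒦⟨ S ⟩ A ≡ false
𝒦-reject S A small = trans (cong ((∣ A ∣ ≡ᵇ 3) ∧_) (≤ᵇ-false small)) (∧-zeroʳ _)

𝒦-reject⁻ : ∀ {n} (S A : Subset n) → ∣ A ∣ ≡ 3 → 𝒦⟨ S ⟩ A ≡ false → ∣ A ∩ S ∣ < 2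
𝒦-reject⁻ S A size A∉ = ℕ.≰⇒> λ meets → true≢false (trans (sym (𝒦-intro S A size meets)) A∉)

-- move x y A = (A ∖ {x}) ∪ {y}; on sets containing x but not y this is σ_{x,y}.
move : ∀ {n} → Fin n → Fin n → Subset n → Subset n
move x y A = (A [ x ]≔ false) [ y ]≔ true

member≢outsider : ∀ {n} (A : Subset n) {x y} → lookup A x ≡ true → lookup A y ≡ false → x ≢ y
member≢outsider A x∈A y∉A refl = true≢false (trans (sym x∈A) y∉A)

move-target : ∀ {n} (x y : Fin n) A → lookup (move x y A) y ≡ true
move-target x y A = lookup∘update y (A [ x ]≔ false) true

move-source : ∀ {n} {x y : Fin n} A → x ≢ y → lookup (move x y A) x ≡ false
move-source {x = x} {y} A x≢y = trans (lookup∘update′ x≢y (A [ x ]≔ false) true) (lookup∘update x A false)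

move-other : ∀ {n} {x y z : Fin n} A → z ≢ x → z ≢ y → lookup (move x y A) z ≡ lookup A z
move-other {x = x} {y} A z≢x z≢y = trans (lookup∘update′ z≢y (A [ x ]≔ false) true) (lookup∘update′ z≢x A false)

move-∩ : ∀ {n} {x y : Fin n} (A S : Subset n) → lookup A x ≡ true → lookup A y ≡ false →
  ∣ move x y A ∩ S ∣ + ⟦ lookup S x ⟧ ≡ ⟦ lookup S y ⟧ + ∣ A ∩ S ∣
move-∩ {x = x} {y} A S x∈A y∉A = begin
  ∣ move x y A ∩ S ∣ + ⟦ lookup S x ⟧          ≡⟨ cong (_+ ⟦ lookup S x ⟧) (∩-insert A⁻ S y y∉A⁻) ⟩
  ⟦ lookup S y ⟧ + ∣ A⁻ ∩ S ∣ + ⟦ lookup S x ⟧  ≡⟨ ℕ.+-assoc ⟦ lookup S y ⟧ _ _ ⟩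
  ⟦ lookup S y ⟧ + (∣ A⁻ ∩ S ∣ + ⟦ lookup S x ⟧) ≡⟨ cong (⟦ lookup S y ⟧ +_) (ℕ.+-comm ∣ A⁻ ∩ S ∣ _) ⟩
  ⟦ lookup S y ⟧ + (⟦ lookup S x ⟧ + ∣ A⁻ ∩ S ∣) ≡⟨ cong (⟦ lookup S y ⟧ +_) (sym (∩-remove A S x x∈A)) ⟩
  ⟦ lookup S y ⟧ + ∣ A ∩ S ∣                    ∎
  where
  open ≡-Reasoning
  A⁻ = A [ x ]≔ false
  y∉A⁻ : lookup A⁻ y ≡ false
  y∉A⁻ = trans (lookup∘update′ (≢-sym (member≢outsider A x∈A y∉A)) A false) y∉A

move-card : ∀ {n} {x y : Fin n} (A : Subset n) → lookup A x ≡ true → lookup A y ≡ false → ∣ move x y A ∣ ≡ ∣ A ∣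
move-card {x = x} {y} A x∈A y∉A = begin
  ∣ move x y A ∣           ≡⟨ card-insert (A [ x ]≔ false) y (trans (lookup∘update′ y≢x A false) y∉A) ⟩
  suc ∣ A [ x ]≔ false ∣   ≡⟨ sym (card-remove A x x∈A) ⟩
  ∣ A ∣                    ∎
  where
  open ≡-Reasoning
  y≢x = ≢-sym (member≢outsider A x∈A y∉A)

move-injective : ∀ {n} {x y : Fin n} (P Q : Subset n) →
  lookup P x ≡ true → lookup P y ≡ false → lookup Q x ≡ true → lookup Q y ≡ false →
  move x y P ≡ move x y Q → P ≡ Q
move-injective {x = x} {y} P Q x∈P y∉P x∈Q y∉Q same = subset-ext P Q pointwise
  where
  pointwise : ∀ z → lookup P z ≡ lookup Q z
  pointwise z with z ≟ x | z ≟ y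
  ... | yes refl | _ = trans x∈P (sym x∈Q)
  ... | no _ | yes refl = trans y∉P (sym y∉Q)
  ... | no z≢x | no z≢y =
    trans (sym (move-other P z≢x z≢y)) (trans (cong (λ A → lookup A z) same) (move-other Q z≢x z≢y))

move-triple : ∀ {n} {x y w v : Fin n} → x ≢ y → w ≢ x → w ≢ y → v ≢ x → v ≢ y → w ≢ v →
  move x y (triple x w v) ≡ triple w y v
move-triple {x = x} {y} {w} {v} x≢y w≢x w≢y v≢x v≢y w≢v = subset-ext _ _ pointwise
  where
  pointwise : ∀ z → lookup (move x y (triple x w v)) z ≡ lookup (triple w y v) z
  pointwise z with z ≟ x | z ≟ y
  ... | yes refl | _ = trans (move-source (triple z w v) x≢y) (sym (triple-∌ (≢-sym w≢x) x≢y (≢-sym v≢x)))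
  ... | no _ | yes refl = trans (move-target x z (triple x w v)) (sym (triple-∋₂ w z v))
  ... | no z≢x | no z≢y = trans (move-other (triple x w v) z≢x z≢y) (same-rest z≢x z≢y)
    where
    same-rest : z ≢ x → z ≢ y → lookup (triple x w v) z ≡ lookup (triple w y v) z
    same-rest z≢x z≢y with z ≟ w | z ≟ v
    ... | yes refl | _ = trans (triple-∋₂ x z v) (sym (triple-∋₁ z y v))
    ... | no _ | yes refl = trans (triple-∋₃ x w z) (sym (triple-∋₃ w y z))
    ... | no z≢w | no z≢v = trans (triple-∌ z≢x z≢w z≢v) (sym (triple-∌ z≢w z≢y z≢v))

-- Images under permutations: π(A) has the size of A, and π⁻¹(𝒦) = 𝒦⟨ π⁻¹([3]) ⟩.

permImage-lookup : ∀ {n} (ρ : Permutation n n) A y → lookup (permImage ρ A) y ≡ lookup A (ρ ⟨$⟩ˡ y)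
permImage-lookup ρ A y = lookup∘tabulate _ y

permImage-update : ∀ {n} (ρ : Permutation n n) v x b →
  permImage ρ (v [ x ]≔ b) ≡ permImage ρ v [ ρ ⟨$⟩ʳ x ]≔ b
permImage-update ρ v x b = subset-ext _ _ pointwise
  where
  pointwise : ∀ y → lookup (permImage ρ (v [ x ]≔ b)) y ≡ lookup (permImage ρ v [ ρ ⟨$⟩ʳ x ]≔ b) y
  pointwise y with y ≟ ρ ⟨$⟩ʳ x
  ... | yes refl = begin
    lookup (permImage ρ (v [ x ]≔ b)) (ρ ⟨$⟩ʳ x) ≡⟨ permImage-lookup ρ (v [ x ]≔ b) _ ⟩
    lookup (v [ x ]≔ b) (ρ ⟨$⟩ˡ (ρ ⟨$⟩ʳ x))      ≡⟨ cong (lookup (v [ x ]≔ b)) (inverseˡ ρ) ⟩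
    lookup (v [ x ]≔ b) x                        ≡⟨ lookup∘update x v b ⟩
    b                                            ≡⟨ sym (lookup∘update (ρ ⟨$⟩ʳ x) (permImage ρ v) b) ⟩
    lookup (permImage ρ v [ ρ ⟨$⟩ʳ x ]≔ b) (ρ ⟨$⟩ʳ x) ∎
    where open ≡-Reasoning
  ... | no y≢ρx = begin
    lookup (permImage ρ (v [ x ]≔ b)) y ≡⟨ permImage-lookup ρ (v [ x ]≔ b) y ⟩
    lookup (v [ x ]≔ b) (ρ ⟨$⟩ˡ y)      ≡⟨ lookup∘update′ (λ e → y≢ρx (trans (sym (inverseʳ ρ)) (cong (ρ ⟨$⟩ʳ_) e))) v b ⟩
    lookup v (ρ ⟨$⟩ˡ y)                 ≡⟨ sym (permImage-lookup ρ v y) ⟩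
    lookup (permImage ρ v) y            ≡⟨ sym (lookup∘update′ y≢ρx (permImage ρ v) b) ⟩
    lookup (permImage ρ v [ ρ ⟨$⟩ʳ x ]≔ b) y ∎
    where open ≡-Reasoning

card-permImage : ∀ {n} (ρ : Permutation n n) (A : Subset n) → ∣ permImage ρ A ∣ ≡ ∣ A ∣
card-permImage ρ A = of-size ∣ A ∣ A refl
  where
  of-size : ∀ k A → ∣ A ∣ ≡ k → ∣ permImage ρ A ∣ ≡ k
  of-size zero A empty = no-members (permImage ρ A) λ y → trans (permImage-lookup ρ A y) (empty-lookup A empty _)
  of-size (suc k) A size with some-member A size
  ... | x , x∈A = begin
    ∣ permImage ρ A ∣                              ≡⟨ cong (λ B → ∣ permImage ρ B ∣) (reinsert A x x∈A) ⟩
    ∣ permImage ρ (A⁻ [ x ]≔ true) ∣              ≡⟨ cong ∣_∣ (permImage-update ρ A⁻ x true) ⟩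
    ∣ permImage ρ A⁻ [ ρ ⟨$⟩ʳ x ]≔ true ∣         ≡⟨ card-insert (permImage ρ A⁻) (ρ ⟨$⟩ʳ x) ρx∉ ⟩
    suc ∣ permImage ρ A⁻ ∣                         ≡⟨ cong suc (of-size k A⁻ (peel A x x∈A size)) ⟩
    suc k                                          ∎
    where
    open ≡-Reasoning
    A⁻ = A [ x ]≔ false
    ρx∉ : lookup (permImage ρ A⁻) (ρ ⟨$⟩ʳ x) ≡ false
    ρx∉ = trans (permImage-lookup ρ A⁻ _) (trans (cong (lookup A⁻) (inverseˡ ρ)) (lookup∘update x A false))

-- The set T = ρ⁻¹([3]), for which ρ(A) ∈ 𝒦 exactly when A ∈ 𝒦⟨ T ⟩.
preimage3 : ∀ {n} → Permutation n n → Subset n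
preimage3 ρ = permImage (flip ρ) first3

permImage-∩ : ∀ {n} (ρ : Permutation n n) A → permImage ρ A ∩ first3 ≡ permImage ρ (A ∩ preimage3 ρ)
permImage-∩ ρ A = subset-ext _ _ λ y → begin
  lookup (permImage ρ A ∩ first3) y                 ≡⟨ ∩-lookup (permImage ρ A) first3 y ⟩
  lookup (permImage ρ A) y ∧ lookup first3 y        ≡⟨ cong₂ _∧_ (permImage-lookup ρ A y) (cong (lookup first3) (sym (inverseʳ ρ))) ⟩
  lookup A (ρ ⟨$⟩ˡ y) ∧ lookup first3 (ρ ⟨$⟩ʳ (ρ ⟨$⟩ˡ y))
                          ≡⟨ cong (lookup A (ρ ⟨$⟩ˡ y) ∧_) (sym (permImage-lookup (flip ρ) first3 (ρ ⟨$⟩ˡ y))) ⟩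
  lookup A (ρ ⟨$⟩ˡ y) ∧ lookup (preimage3 ρ) (ρ ⟨$⟩ˡ y) ≡⟨ sym (∩-lookup A (preimage3 ρ) (ρ ⟨$⟩ˡ y)) ⟩
  lookup (A ∩ preimage3 ρ) (ρ ⟨$⟩ˡ y)               ≡⟨ sym (permImage-lookup ρ (A ∩ preimage3 ρ) y) ⟩
  lookup (permImage ρ (A ∩ preimage3 ρ)) y          ∎
  where open ≡-Reasoning

𝒦-permImage : ∀ {n} (ρ : Permutation n n) A → 𝒦 (permImage ρ A) ≡ 𝒦⟨ preimage3 ρ ⟩ A
𝒦-permImage ρ A = cong₂ (λ size meet → (size ≡ᵇ 3) ∧ (2 ≤ᵇ meet)) (card-permImage ρ A)
  (trans (cong ∣_∣ (permImage-∩ ρ A)) (card-permImage ρ (A ∩ preimage3 ρ)))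

card-first3 : ∀ {n} → 3 ≤ n → ∣ first3 {n} ∣ ≡ 3
card-first3 {zero} ()
card-first3 {suc zero} (s≤s ())
card-first3 {suc (suc zero)} (s≤s (s≤s ()))
card-first3 {suc (suc (suc m))} _ =
  cong (3 +_) (no-members (tabulate λ (_ : Fin m) → false) λ x → lookup∘tabulate (λ _ → false) x)

card-preimage3 : ∀ {n} → 3 ≤ n → (ρ : Permutation n n) → ∣ preimage3 ρ ∣ ≡ 3
card-preimage3 3≤n ρ = trans (card-permImage (flip ρ) first3) (card-first3 3≤n)

≅𝒦 : ∀ {n} (F : Family n) (ρ : Permutation n n) → (∀ A → F A ≡ 𝒦⟨ preimage3 ρ ⟩ A) → F ≅ 𝒦
≅𝒦 F ρ F≡ = ρ , λ A → trans (F≡ A) (sym (𝒦-permImage ρ A))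

preimage3-transpose : ∀ {n} (ρ : Permutation n n) (i j : Fin n) →
  lookup (preimage3 ρ) j ≡ true → lookup (preimage3 ρ) i ≡ false →
  preimage3 (transpose i j ∘ₚ ρ) ≡ move j i (preimage3 ρ)
preimage3-transpose ρ i j j∈T i∉T = subset-ext _ _ λ w →
  trans (lookup∘tabulate _ w) (trans (sym (lookup∘tabulate _ (Components.transpose i j w))) (pointwise w))
  where
  S = preimage3 ρ
  pointwise : ∀ w → lookup S (Components.transpose i j w) ≡ lookup (move j i S) w
  pointwise w with w ≟ i
  ... | yes refl = trans j∈T (sym (move-target j w S))
  ... | no w≢i with w ≟ j
  ...   | yes refl = trans i∉T (sym (move-source S (member≢outsider S j∈T i∉T)))
  ...   | no w≢j = sym (move-other S w≢j w≢i)

record Through {n} (T : Subset n) (j : Fin n) : Set where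
  field
    u b : Fin n
    u∈T : lookup T u ≡ true
    b∈T : lookup T b ≡ true
    u≢j : u ≢ j
    b≢j : b ≢ j
    u≢b : u ≢ b
    only : ∀ w → lookup T w ≡ true → w ≡ j ⊎ w ≡ u ⊎ w ≡ b

covered-by : ∀ {n} (T : Subset n) j u b → (∀ w → lookup (((T [ j ]≔ false) [ u ]≔ false) [ b ]≔ false) w ≡ false) →
  ∀ w → lookup T w ≡ true → w ≡ j ⊎ w ≡ u ⊎ w ≡ b
covered-by T j u b nothing-left w w∈T with w ≟ j | w ≟ u | w ≟ b
... | yes w≡j | _ | _ = inj₁ w≡j
... | no _ | yes w≡u | _ = inj₂ (inj₁ w≡u)
... | no _ | no _ | yes w≡b = inj₂ (inj₂ w≡b)
... | no w≢j | no w≢u | no w≢b = true≢false (trans (sym left) (nothing-left w))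
  where
  left = still-member ((T [ j ]≔ false) [ u ]≔ false) w≢b (still-member (T [ j ]≔ false) w≢u (still-member T w≢j w∈T))

through : ∀ {n} (T : Subset n) j → ∣ T ∣ ≡ 3 → lookup T j ≡ true → Through T j
through T j size j∈T with some-member (T [ j ]≔ false) (peel T j j∈T size)
... | u , u∈T₁ with some-member ((T [ j ]≔ false) [ u ]≔ false) (peel (T [ j ]≔ false) u u∈T₁ (peel T j j∈T size))
...   | b , b∈T₂ = record
        { u = u ; b = b ; u∈T = proj₂ u-facts ; b∈T = proj₂ b∈T₁-facts
        ; u≢j = proj₁ u-facts ; b≢j = proj₁ b∈T₁-facts ; u≢b = ≢-sym (proj₁ b-facts)
        ; only = covered-by T j u b (empty-lookup T₃ (peel T₂ b b∈T₂ (peel T₁ u u∈T₁ (peel T j j∈T size)))) }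
  where
  T₁ = T [ j ]≔ false
  T₂ = T₁ [ u ]≔ false
  T₃ = T₂ [ b ]≔ false
  u-facts = removed-member T u∈T₁
  b-facts = removed-member T₁ b∈T₂
  b∈T₁-facts = removed-member T (proj₂ b-facts)

-- Shifting: what σ_{i,j}(G′) = G says about G′, for arbitrary families.

IsShift-cong : ∀ {n} {i j : Fin n} {G′ G H : Family n} → (∀ B → G B ≡ H B) → IsShift i j G′ G → IsShift i j G′ H
IsShift-cong G≡H shift B = (λ B∈H → proj₁ (shift B) (trans (G≡H B) B∈H))
                         , (λ from → trans (sym (G≡H B)) (proj₂ (shift B) from))

module Shifting {n} {i j : Fin n} {G′ G : Family n} (shift : IsShift i j G′ G) where

  σ′-cases : ∀ A → σ' i j G′ A ≡ A ⊎ (lookup A i ≡ true × lookup A j ≡ false × σ' i j G′ A ≡ move i j A)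
  σ′-cases A with lookup A i in A∋i | lookup A j in A∋j
  ... | true | false with G′ (move i j A)
  ...   | true = inj₁ refl
  ...   | false = inj₂ (refl , refl , refl)
  σ′-cases A | true | true = inj₁ (if-same (G′ A) A)
  σ′-cases A | false | _ = inj₁ (if-same (G′ A) A)

  image : ∀ A → G′ A ≡ true → G (σ' i j G′ A) ≡ true
  image A A∈ = proj₂ (shift (σ' i j G′ A)) (A , A∈ , refl)

  keeps-j-free : ∀ B → G B ≡ true → lookup B j ≡ false → G′ B ≡ true
  keeps-j-free B B∈ B∌j with proj₁ (shift B) B∈
  ... | A , A∈ , σA≡B with σ′-cases A
  ...   | inj₁ fixed = subst (λ X → G′ X ≡ true) (trans (sym fixed) σA≡B) A∈
  ...   | inj₂ (_ , _ , moved) =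
          true≢false (trans (sym (move-target i j A)) (trans (cong (λ X → lookup X j) (trans (sym moved) σA≡B)) B∌j))

  keeps-i : ∀ B → G B ≡ true → lookup B i ≡ true → G′ B ≡ true × σ' i j G′ B ≡ B
  keeps-i B B∈ B∋i with proj₁ (shift B) B∈
  ... | A , A∈ , σA≡B with σ′-cases A
  ...   | inj₁ fixed = subst (λ X → G′ X ≡ true × σ' i j G′ X ≡ X) (trans (sym fixed) σA≡B) (A∈ , fixed)
  ...   | inj₂ (A∋i , A∌j , moved) = true≢false (trans (sym B∋i)
          (trans (cong (λ X → lookup X i) (trans (sym σA≡B) moved)) (move-source A (member≢outsider A A∋i A∌j))))

  record Preimage (B : Subset n) : Set where
    field
      source : Subset n
      source∈G′ : G′ source ≡ true
      source∉G : G source ≡ false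
      source∋i : lookup source i ≡ true
      source∌j : lookup source j ≡ false
      moves-to : move i j source ≡ B

  preimage : ∀ B → G B ≡ true → G′ B ≡ false → Preimage B
  preimage B B∈ B∉ with proj₁ (shift B) B∈
  ... | A , A∈ , σA≡B with σ′-cases A
  ...   | inj₁ fixed = true≢false (trans (sym A∈) (trans (cong G′ (trans (sym fixed) σA≡B)) B∉))
  ...   | inj₂ (A∋i , A∌j , moved) = record
          { source = A ; source∈G′ = A∈ ; source∉G = ¬-not A∉G ; source∋i = A∋i ; source∌j = A∌j
          ; moves-to = trans (sym moved) σA≡B }
    where
    A∉G : G A ≢ true
    A∉G A∈G = true≢false (trans (sym A∋i) (trans (cong (λ X → lookup X i) (trans (sym (proj₂ (keeps-i A A∈G A∋i))) moved))
                (move-source A (member≢outsider A A∋i A∌j))))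

  record Escape (A : Subset n) : Set where
    field
      escapee∋i : lookup A i ≡ true
      escapee∌j : lookup A j ≡ false
      moved∈G : G (move i j A) ≡ true

  escaped : ∀ A → G′ A ≡ true → G A ≡ false → Escape A
  escaped A A∈ A∉ with σ′-cases A
  ... | inj₁ fixed = true≢false (trans (sym (image A A∈)) (trans (cong G fixed) A∉))
  ... | inj₂ (A∋i , A∌j , moved) = record
        { escapee∋i = A∋i ; escapee∌j = A∌j ; moved∈G = subst (λ X → G X ≡ true) moved (image A A∈) }

  stable : ∀ A → lookup A i ≡ lookup A j → G′ A ≡ G A
  stable A same = bool-ext forward backward
    where
    forward : G′ A ≡ true → G A ≡ true
    forward A∈ = ¬-not λ A∉ → let open Escape (escaped A A∈ A∉) in
      true≢false (trans (sym escapee∋i) (trans same escapee∌j))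
    backward : G A ≡ true → G′ A ≡ true
    backward A∈ with lookup A j in A∋j
    ... | false = keeps-j-free A A∈ A∋j
    ... | true = proj₁ (keeps-i A A∈ same)

  -- If G′ ⊆ G then G′ = G, since a set of G ∖ G′ would have a preimage in G′ ∖ G.
  ⊆⇒≡ : (∀ A → G′ A ≡ true → G A ≡ true) → ∀ A → G′ A ≡ G A
  ⊆⇒≡ G′⊆G A = bool-ext (G′⊆G A) λ A∈ → ¬-not λ A∉ →
    let open Preimage (preimage A A∈ A∉) in
    true≢false (trans (sym (G′⊆G source source∈G′)) source∉G)

-- Undoing a shift onto 𝒦⟨ T ⟩.

-- The two ways in which an intersecting G′ can shift onto 𝒦⟨ T ⟩: nothing moved, or
-- j ∈ T, i ∉ T and G′ is the copy of 𝒦⟨ T ⟩ centred at T′ = (T ∖ {j}) ∪ {i}.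
data ShiftOrigin {n} (G′ : Family n) (i j : Fin n) (T : Subset n) : Set where
  unchanged : (∀ A → G′ A ≡ 𝒦⟨ T ⟩ A) → ShiftOrigin G′ i j T
  swapped : lookup T j ≡ true → lookup T i ≡ false → (∀ A → G′ A ≡ 𝒦⟨ move j i T ⟩ A) → ShiftOrigin G′ i j T

indicator-≤ : ∀ x c a b → x + ⟦ a ⟧ ≡ ⟦ b ⟧ + c → ¬ (b ≡ true × a ≡ false) → x ≤ c
indicator-≤ x c true true count _ = ℕ.≤-reflexive (ℕ.suc-injective (trans (ℕ.+-comm 1 x) count))
indicator-≤ x c true false count _ = ℕ.≤-trans (ℕ.m≤m+n x 1) (ℕ.≤-reflexive count)
indicator-≤ x c false false count _ = ℕ.≤-trans (ℕ.m≤m+n x 0) (ℕ.≤-reflexive count)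
indicator-≤ x c false true count not-swap = ⊥-elim (not-swap (refl , refl))

2≰1 : ¬ 2 ≤ 1
2≰1 (s≤s ())

module Unshifting {n} (7≤n : 7 ≤ n) (G′ : Family n) (i j : Fin n) (triples : ⊆Triples G′)
  (intersecting : Intersecting G′) (T : Subset n) (∣T∣≡3 : ∣ T ∣ ≡ 3) (shift : IsShift i j G′ 𝒦⟨ T ⟩) where
  open Shifting shift

  excluded-by : ∀ C A → G′ C ≡ true → ¬ Nonempty (C ∩ A) → G′ A ≡ false
  excluded-by C A C∈ disjoint = ¬-not λ A∈ → disjoint (intersecting C A C∈ A∈)

  -- Unless j ∈ T and i ∉ T, the move i → j never raises |A ∩ T|, so no set escapes 𝒦⟨ T ⟩.
  no-escape : ¬ (lookup T j ≡ true × lookup T i ≡ false) → ∀ A → G′ A ≡ true → 𝒦⟨ T ⟩ A ≡ true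
  no-escape not-swap A A∈ = ¬-not λ A∉ → true≢false (trans (sym (𝒦-intro T A (triples A A∈) (meets A∉))) A∉)
    where
    meets : 𝒦⟨ T ⟩ A ≡ false → 2 ≤ ∣ A ∩ T ∣
    meets A∉ = ℕ.≤-trans (𝒦-elim T (move i j A) moved∈G)
                 (indicator-≤ _ _ (lookup T i) (lookup T j) (move-∩ A T escapee∋i escapee∌j) not-swap)
      where open Escape (escaped A A∈ A∉)

  module Swapped (T∋j : lookup T j ≡ true) (T∌i : lookup T i ≡ false) (T-view : Through T j) where
    open Through T-view

    i≢j : i ≢ j
    i≢j = ≢-sym (member≢outsider T T∋j T∌i)

    T′ : Subset n
    T′ = move j i T

    Outside : Fin n → Set
    Outside y = lookup T y ≡ false × y ≢ i

    outside : ∀ a c → ∃ λ y → Outside y × y ≢ a × y ≢ c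
    outside a c = repackage (fresh 7≤n T (ℕ.≤-reflexive ∣T∣≡3) i a c)
      where
      repackage : (∃ λ y → lookup T y ≡ false × y ≢ i × y ≢ a × y ≢ c) → ∃ λ y → Outside y × y ≢ a × y ≢ c
      repackage (y , T∌y , y≢i , y≢a , y≢c) = y , (T∌y , y≢i) , y≢a , y≢c

    avoiding : ∀ {y} → y ≢ i → y ≢ j → y ≢ u → y ≢ b → Outside y
    avoiding y≢i y≢j y≢u y≢b = ¬-not (λ T∋y → [ y≢j , [ y≢u , y≢b ]′ ]′ (only _ T∋y)) , y≢i

    -- A 3-set through i or j misses some point outside T ∪ {i}: avoid it and the other three of i, j, u, b.
    outside-of : ∀ A → ∣ A ∣ ≡ 3 → lookup A i ≡ true ⊎ lookup A j ≡ true → ∃ λ y → Outside y × lookup A y ≡ false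
    outside-of A size (inj₁ A∋i) = repackage (fresh 7≤n A (ℕ.≤-reflexive size) j u b)
      where
      repackage : (∃ λ y → lookup A y ≡ false × y ≢ j × y ≢ u × y ≢ b) → ∃ λ y → Outside y × lookup A y ≡ false
      repackage (y , A∌y , y≢j , y≢u , y≢b) = y , avoiding (≢-sym (member≢outsider A A∋i A∌y)) y≢j y≢u y≢b , A∌y
    outside-of A size (inj₂ A∋j) = repackage (fresh 7≤n A (ℕ.≤-reflexive size) i u b)
      where
      repackage : (∃ λ y → lookup A y ≡ false × y ≢ i × y ≢ u × y ≢ b) → ∃ λ y → Outside y × lookup A y ≡ false
      repackage (y , A∌y , y≢i , y≢u , y≢b) = y , avoiding y≢i (≢-sym (member≢outsider A A∋j A∌y)) y≢u y≢b , A∌y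

    data Partners : Fin n → Fin n → Set where
      u-b : Partners u b
      b-u : Partners b u

    swap : ∀ {w w′} → Partners w w′ → Partners w′ w
    swap u-b = b-u
    swap b-u = u-b

    partner∈T : ∀ {w w′} → Partners w w′ → lookup T w ≡ true
    partner∈T u-b = u∈T
    partner∈T b-u = b∈T

    partner≢j : ∀ {w w′} → Partners w w′ → w ≢ j
    partner≢j u-b = u≢j
    partner≢j b-u = b≢j

    partners-≢ : ∀ {w w′} → Partners w w′ → w ≢ w′
    partners-≢ u-b = u≢b
    partners-≢ b-u = ≢-sym u≢b

    missing-partner : ∀ A → ¬ (lookup A u ≡ true × lookup A b ≡ true) →
      ∃ λ w → ∃ λ w′ → Partners w w′ × lookup A w ≡ false
    missing-partner A not-both = decide (lookup A u) (lookup A b) refl refl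
      where
      decide : ∀ x y → lookup A u ≡ x → lookup A b ≡ y → ∃ λ w → ∃ λ w′ → Partners w w′ × lookup A w ≡ false
      decide false _ A∌u _ = u , b , u-b , A∌u
      decide true false _ A∌b = b , u , b-u , A∌b
      decide true true A∋u A∋b = ⊥-elim (not-both (A∋u , A∋b))

    -- {i, w, y} ∈ G′: before the shift, the set {w, j, y} of 𝒦⟨ T ⟩ sat at {i, w, y}.
    Lifted : Fin n → Fin n → Set
    Lifted w y = G′ (triple i w y) ≡ true

    through-j∈𝒦 : ∀ {w y} → lookup T w ≡ true → w ≢ j → lookup T y ≡ false → 𝒦⟨ T ⟩ (triple w j y) ≡ true
    through-j∈𝒦 {w} {y} T∋w w≢j T∌y = 𝒦-intro T (triple w j y) (triple-card w j y w≢j w≢y j≢y)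
      (ℕ.≤-reflexive (sym (trans (triple-∩ w j y T w≢j w≢y j≢y)
        (cong₂ (λ a c → ⟦ a ⟧ + c) T∌y (cong₂ (λ a c → ⟦ a ⟧ + ⟦ c ⟧) T∋j T∋w)))))
      where
      w≢y = member≢outsider T T∋w T∌y
      j≢y = member≢outsider T T∋j T∌y

    lifted∉𝒦 : ∀ {w v} → lookup T w ≡ true → Outside v → 𝒦⟨ T ⟩ (triple i w v) ≡ false
    lifted∉𝒦 {w} {v} T∋w (T∌v , v≢i) = 𝒦-reject T (triple i w v)
      (subst (_< 2) (sym (trans (triple-∩ i w v T i≢w (≢-sym v≢i) w≢v)
        (cong₂ (λ a c → ⟦ a ⟧ + c) T∌v (cong₂ (λ a c → ⟦ a ⟧ + ⟦ c ⟧) T∋w T∌i)))) (s≤s (s≤s z≤n)))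
      where
      i≢w = ≢-sym (member≢outsider T T∋w T∌i)
      w≢v = member≢outsider T T∋w T∌v

    -- Given C ∈ G′ ∖ 𝒦⟨ T ⟩, each w ∈ T ∖ {j} and outside y missed by C give {i, w, y} ∈ G′:
    -- B = {w, j, y} ∈ 𝒦⟨ T ⟩ misses C (as j ∉ C), so B ∉ G′, and B's preimage can only be {i, w, y}.
    lift : ∀ C {w y} → G′ C ≡ true → 𝒦⟨ T ⟩ C ≡ false → lookup T w ≡ true → w ≢ j →
           lookup C w ≡ false → Outside y → lookup C y ≡ false → Lifted w y
    lift C {w} {y} C∈ C∉ T∋w w≢j C∌w (T∌y , y≢i) C∌y = subst (λ X → G′ X ≡ true) source≡ source∈G′
      where
      B = triple w j y
      B∉ : G′ B ≡ false
      B∉ = excluded-by C B C∈ λ meet →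
        triple-disjoint C C∌w (Escape.escapee∌j (escaped C C∈ C∉)) C∌y (subst Nonempty (∩-comm C B) meet)
      open Preimage (preimage B (through-j∈𝒦 T∋w w≢j T∌y) B∉)
      w≢i = member≢outsider T T∋w T∌i
      w≢y = member≢outsider T T∋w T∌y
      y≢j = ≢-sym (member≢outsider T T∋j T∌y)
      source≡ : source ≡ triple i w y
      source≡ = move-injective source (triple i w y) source∋i source∌j (triple-∋₁ i w y)
        (triple-∌ (≢-sym i≢j) (≢-sym w≢j) (≢-sym y≢j))
        (trans moves-to (sym (move-triple i≢j w≢i w≢j y≢i y≢j w≢y)))

    -- {i, w, v} ∈ G′ lies outside 𝒦⟨ T ⟩, so `lift` applies to it with the partner w′ of w.
    hop : ∀ {w w′ v y} → Partners w w′ → Outside v → Lifted w v → Outside y → y ≢ v → Lifted w′ y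
    hop {w} {w′} {v} {y} p v-out Lwv (T∌y , y≢i) y≢v =
      lift (triple i w v) Lwv (lifted∉𝒦 (partner∈T p) v-out) (partner∈T (swap p)) (partner≢j (swap p))
        (triple-∌ (member≢outsider T (partner∈T (swap p)) T∌i) (≢-sym (partners-≢ p))
                  (member≢outsider T (partner∈T (swap p)) (proj₁ v-out)))
        (T∌y , y≢i)
        (triple-∌ y≢i (≢-sym (member≢outsider T (partner∈T p) T∌y)) y≢v)

    -- A few hops reach every outside point: {i, w, v} ∈ G′ gives {i, w′, y} ∈ G′ for all outside y.
    spread : ∀ {w w′ v} → Partners w w′ → Outside v → Lifted w v → ∀ {y} → Outside y → Lifted w′ y
    spread {v = v} p v-out Lwv {y} y-out with y ≟ v
    ... | no y≢v = hop p v-out Lwv y-out y≢v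
    ... | yes refl with outside v v
    ...   | v₁ , v₁-out , v₁≢v , _ with outside v₁ v
    ...     | v₂ , v₂-out , v₂≢v₁ , v₂≢v =
              hop p v₂-out (hop (swap p) v₁-out (hop p v-out Lwv v₁-out v₁≢v) v₂-out v₂≢v₁) y-out (≢-sym v₂≢v)

    AllLifted : Set
    AllLifted = ∀ {y} → Outside y → Lifted u y × Lifted b y

    everywhere : ∀ {w w′ v} → Partners w w′ → Outside v → Lifted w v → AllLifted
    everywhere p v-out Lwv y-out = both p (spread (swap p) v-out (spread p v-out Lwv v-out) y-out) (spread p v-out Lwv y-out)
      where
      both : ∀ {w w′ y} → Partners w w′ → Lifted w y → Lifted w′ y → Lifted u y × Lifted b y
      both u-b Lw Lw′ = Lw , Lw′
      both b-u Lw Lw′ = Lw′ , Lw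

    lifted-at : AllLifted → ∀ {w w′ y} → Partners w w′ → Outside y → Lifted w y
    lifted-at lifted u-b y-out = proj₁ (lifted y-out)
    lifted-at lifted b-u y-out = proj₂ (lifted y-out)

    -- A single set of G′ ∖ 𝒦⟨ T ⟩ starts the propagation: it contains i, misses u or b and some outside point.
    escape⇒all-lifted : ∀ A → G′ A ≡ true → 𝒦⟨ T ⟩ A ≡ false → AllLifted
    escape⇒all-lifted A A∈ A∉ with missing-partner A not-both | outside-of A size (inj₁ (Escape.escapee∋i (escaped A A∈ A∉)))
      where
      size = triples A A∈
      not-both : ¬ (lookup A u ≡ true × lookup A b ≡ true)
      not-both (A∋u , A∋b) = ℕ.<⇒≱ (𝒦-reject⁻ T A size A∉)
        (two-members (A ∩ T) u b u≢b (∩-member A T A∋u u∈T) (∩-member A T A∋b b∈T))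
    ... | w , _ , p , A∌w | y , y-out , A∌y =
          everywhere p y-out (lift A A∈ A∉ (partner∈T p) (partner≢j p) A∌w y-out A∌y)

    -- With all lifted triples present, a 3-set through j avoiding i and meeting T twice is not in G′:
    -- it misses u or b and some outside point, so it is disjoint from a lifted triple.
    j-excluded : AllLifted → ∀ A → ∣ A ∣ ≡ 3 → lookup A i ≡ false → lookup A j ≡ true → ∣ A ∩ T ∣ ≡ 2 → G′ A ≡ false
    j-excluded lifted A size A∌i A∋j meets with missing-partner A not-both | outside-of A size (inj₂ A∋j)
      where
      not-both : ¬ (lookup A u ≡ true × lookup A b ≡ true)
      not-both (A∋u , A∋b) = 2≰1 (ℕ.≤-pred (subst (3 ≤_) meets
        (three-members (A ∩ T) j u b (≢-sym u≢j) (≢-sym b≢j) u≢b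
          (∩-member A T A∋j T∋j) (∩-member A T A∋u u∈T) (∩-member A T A∋b b∈T))))
    ... | w , _ , p , A∌w | y , y-out , A∌y =
          excluded-by (triple i w y) A (lifted-at lifted p y-out) (triple-disjoint A A∌i A∌w A∌y)

    move-gains : ∀ A → lookup A i ≡ true → lookup A j ≡ false → ∣ move i j A ∩ T ∣ ≡ suc ∣ A ∩ T ∣
    move-gains A A∋i A∌j = begin
      ∣ move i j A ∩ T ∣                     ≡⟨ sym (ℕ.+-identityʳ _) ⟩
      ∣ move i j A ∩ T ∣ + ⟦ false ⟧         ≡⟨ cong (λ a → ∣ move i j A ∩ T ∣ + ⟦ a ⟧) (sym T∌i) ⟩
      ∣ move i j A ∩ T ∣ + ⟦ lookup T i ⟧    ≡⟨ move-∩ A T A∋i A∌j ⟩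
      ⟦ lookup T j ⟧ + ∣ A ∩ T ∣             ≡⟨ cong (λ a → ⟦ a ⟧ + ∣ A ∩ T ∣) T∋j ⟩
      suc ∣ A ∩ T ∣                          ∎
      where open ≡-Reasoning

    T′-count : ∀ A → ∣ A ∩ T′ ∣ + ⟦ lookup A j ⟧ ≡ ⟦ lookup A i ⟧ + ∣ A ∩ T ∣
    T′-count A = subst₂ (λ X Y → ∣ X ∣ + ⟦ lookup A j ⟧ ≡ ⟦ lookup A i ⟧ + ∣ Y ∣) (∩-comm T′ A) (∩-comm T A)
      (move-∩ T A T∋j T∌i)

    -- Sets through i avoiding j: A ∈ G′ iff A meets T, i.e. iff A meets T′ twice.
    i-not-j : AllLifted → ∀ A → ∣ A ∣ ≡ 3 → lookup A i ≡ true → lookup A j ≡ false →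
              ∀ c → ∣ A ∩ T ∣ ≡ c → G′ A ≡ (2 ≤ᵇ suc c)
    i-not-j lifted A size A∋i A∌j zero meets = ¬-not λ A∈ →
      -- A would escape 𝒦⟨ T ⟩, but its move meets T only once
      let A∉ = 𝒦-reject T A (subst (_< 2) (sym meets) (s≤s z≤n)) in
      2≰1 (subst (2 ≤_) (trans (move-gains A A∋i A∌j) (cong suc meets))
                        (𝒦-elim T (move i j A) (Escape.moved∈G (escaped A A∈ A∉))))
    i-not-j lifted A size A∋i A∌j (suc zero) meets = subst (λ X → G′ X ≡ true) source≡A source∈G′
      where
      -- the move B of A lies in 𝒦⟨ T ⟩ but not in G′, so it was moved there, necessarily from A
      B = move i j A
      B-meets : ∣ B ∩ T ∣ ≡ 2
      B-meets = trans (move-gains A A∋i A∌j) (cong suc meets)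
      B-size : ∣ B ∣ ≡ 3
      B-size = trans (move-card A A∋i A∌j) size
      B∉ : G′ B ≡ false
      B∉ = j-excluded lifted B B-size (move-source A i≢j) (move-target i j A) B-meets
      open Preimage (preimage B (𝒦-intro T B B-size (ℕ.≤-reflexive (sym B-meets))) B∉)
      source≡A : source ≡ A
      source≡A = move-injective source A source∋i source∌j A∋i A∌j moves-to
    i-not-j lifted A size A∋i A∌j (suc (suc k)) meets =
      keeps-j-free A (𝒦-intro T A size (subst (2 ≤_) (sym meets) (s≤s (s≤s z≤n)))) A∌j

    -- Sets through j avoiding i: A ∈ G′ iff A meets T ∖ {j}, i.e. T′, twice.
    j-not-i : AllLifted → ∀ A → ∣ A ∣ ≡ 3 → lookup A i ≡ false → lookup A j ≡ true →
              ∀ c′ → suc c′ ≡ ∣ A ∩ T ∣ → G′ A ≡ (2 ≤ᵇ c′)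
    j-not-i lifted A size A∌i A∋j zero meets = ¬-not λ A∈ →
      -- A would escape 𝒦⟨ T ⟩, but escapees contain i
      let A∉ = 𝒦-reject T A (subst (_< 2) meets (s≤s (s≤s z≤n))) in
      true≢false (trans (sym (Escape.escapee∋i (escaped A A∈ A∉))) A∌i)
    j-not-i lifted A size A∌i A∋j (suc zero) meets = j-excluded lifted A size A∌i A∋j (sym meets)
    j-not-i lifted A size A∌i A∋j (suc (suc k)) meets = ¬-not missing
      where
      -- A ∈ 𝒦⟨ T ⟩; were it missing from G′, its preimage would lie in 𝒦⟨ T ⟩ too
      A∈𝒦 : 𝒦⟨ T ⟩ A ≡ true
      A∈𝒦 = 𝒦-intro T A size (subst (2 ≤_) meets (s≤s (s≤s z≤n)))
      missing : G′ A ≢ false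
      missing A∉ = true≢false (trans (sym source∈𝒦) source∉G)
        where
        open Preimage (preimage A A∈𝒦 A∉)
        source-meets : ∣ source ∩ T ∣ ≡ suc (suc k)
        source-meets = ℕ.suc-injective (begin
          suc ∣ source ∩ T ∣   ≡⟨ sym (move-gains source source∋i source∌j) ⟩
          ∣ move i j source ∩ T ∣ ≡⟨ cong (λ X → ∣ X ∩ T ∣) moves-to ⟩
          ∣ A ∩ T ∣            ≡⟨ sym meets ⟩
          suc (suc (suc k))    ∎)
          where open ≡-Reasoning
        source∈𝒦 : 𝒦⟨ T ⟩ source ≡ true
        source∈𝒦 = 𝒦-intro T source (triples source source∈G′) (subst (2 ≤_) (sym source-meets) (s≤s (s≤s z≤n)))

    -- With all lifted triples present, G′ = 𝒦⟨ T′ ⟩: split 3-sets by their intersection with {i, j}.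
    swapped-family : AllLifted → ∀ A → G′ A ≡ 𝒦⟨ T′ ⟩ A
    swapped-family lifted A with ∣ A ∣ ℕ.≟ 3
    ... | no size≢3 = trans (¬-not λ A∈ → size≢3 (triples A A∈)) (sym (𝒦-non-triple T′ A size≢3))
    ... | yes size = trans (by-position (lookup A i) (lookup A j) refl refl) (sym (𝒦-on-triples T′ A size))
      where
      count : ∀ {a c} → lookup A i ≡ a → lookup A j ≡ c → ∣ A ∩ T′ ∣ + ⟦ c ⟧ ≡ ⟦ a ⟧ + ∣ A ∩ T ∣
      count refl refl = T′-count A
      untouched : lookup A i ≡ lookup A j → ∣ A ∩ T′ ∣ ≡ ∣ A ∩ T ∣ → G′ A ≡ (2 ≤ᵇ ∣ A ∩ T′ ∣)
      untouched same same-meet = trans (stable A same) (trans (𝒦-on-triples T A size) (cong (2 ≤ᵇ_) (sym same-meet)))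
      by-position : ∀ a c → lookup A i ≡ a → lookup A j ≡ c → G′ A ≡ (2 ≤ᵇ ∣ A ∩ T′ ∣)
      by-position false false A∌i A∌j = untouched (trans A∌i (sym A∌j)) (trans (sym (ℕ.+-identityʳ _)) (count A∌i A∌j))
      by-position true true A∋i A∋j =
        untouched (trans A∋i (sym A∋j)) (ℕ.suc-injective (trans (ℕ.+-comm 1 _) (count A∋i A∋j)))
      by-position true false A∋i A∌j =
        trans (i-not-j lifted A size A∋i A∌j _ refl) (cong (2 ≤ᵇ_) (sym (trans (sym (ℕ.+-identityʳ _)) (count A∋i A∌j))))
      by-position false true A∌i A∋j = j-not-i lifted A size A∌i A∋j _ (trans (ℕ.+-comm 1 _) (count A∌i A∋j))

    -- Decide on one lifted triple: if it lies in G′ everything is lifted and G′ = 𝒦⟨ T′ ⟩;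
    -- otherwise nothing escaped 𝒦⟨ T ⟩ (an escapee would lift it), so G′ = 𝒦⟨ T ⟩.
    origin : ShiftOrigin G′ i j T
    origin with outside u u
    ... | y₀ , y₀-out , _ with G′ (triple i u y₀) in lifted₀
    ...   | true = swapped T∋j T∌i (swapped-family (everywhere u-b y₀-out lifted₀))
    ...   | false = unchanged (⊆⇒≡ λ A A∈ → ¬-not λ A∉ →
              true≢false (trans (sym (proj₁ (escape⇒all-lifted A A∈ A∉ y₀-out))) lifted₀))

  -- Either nothing can escape 𝒦⟨ T ⟩, so G′ = 𝒦⟨ T ⟩, or j ∈ T, i ∉ T and the analysis above applies.
  shift-origin : ShiftOrigin G′ i j T
  shift-origin with lookup T j in T∋j | lookup T i in T∋i
  ... | true | false = Swapped.origin T∋j T∋i (through T j ∣T∣≡3 T∋j)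
  ... | true | true = unchanged (⊆⇒≡ (no-escape λ (_ , T∌i) → true≢false (trans (sym T∋i) T∌i)))
  ... | false | _ = unchanged (⊆⇒≡ (no-escape λ (T∋j′ , _) → false≢true (trans (sym T∋j) T∋j′)))

origin-≅𝒦 : ∀ {n} (G′ : Family n) (i j : Fin n) (ρ : Permutation n n) → ShiftOrigin G′ i j (preimage3 ρ) → G′ ≅ 𝒦
origin-≅𝒦 G′ i j ρ (unchanged G′≡) = ≅𝒦 G′ ρ G′≡
origin-≅𝒦 G′ i j ρ (swapped T∋j T∌i G′≡) = ≅𝒦 G′ (transpose i j ∘ₚ ρ) λ A →
  trans (G′≡ A) (cong (λ S → 𝒦⟨ S ⟩ A) (sym (preimage3-transpose ρ i j T∋j T∌i)))

lemma13 : (n : ℕ) → 7 ≤ n →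
    (G G′ : Family n) → G ≅ 𝒦 → (i j : Fin n) →
    ⊆Triples G′ → Intersecting G′ → IsShift i j G′ G →
    G′ ≅ 𝒦
lemma13 n 7≤n G G′ (ρ , G≡ρ⁻¹𝒦) i j triples intersecting shift =
  origin-≅𝒦 G′ i j ρ (Unshifting.shift-origin 7≤n G′ i j triples intersecting T ∣T∣≡3 shift′)
  where
  T = preimage3 ρ
  ∣T∣≡3 : ∣ T ∣ ≡ 3
  ∣T∣≡3 = card-preimage3 (ℕ.≤-trans (s≤s (s≤s (s≤s z≤n))) 7≤n) ρ
  shift′ : IsShift i j G′ 𝒦⟨ T ⟩
  shift′ = IsShift-cong (λ B → trans (G≡ρ⁻¹𝒦 B) (𝒦-permImage ρ B)) shift
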